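{- For every cyclic formula $\phi$, $\mathsf{GL}^\circ\vdash\Box^\bullet\phi\leftrightarrow\Box\phi$.
   Context: Labels: $\bot,\top$ and propositional variables (arity 0), $\neg,\Box$ (arity 1), $\wedge,\vee,\to$ (arity 2). A graph is $\langle V,r,S,\lambda\rangle$ with $V$ finite, root $r$, labelling $\lambda$, $S:V\to V^{*}$ ordered successors (length = arity of label); every vertex reachable from $r$. A (cyclic) formula is a graph in which every cycle (closed path of pairwise distinct vertices along successors) contains a $\Box$-labelled vertex. Bisimulation: $aRa'$ implies equal labels and $i$-th successors related; $\simeq$ = bisimilarity relating roots. $\phi$ modalised in $p$: every root-to-$p$ path passes a $\Box$-labelled vertex; then $\digamma p.\phi$ identifies the root with all $p$-labelled vertices (keeping the root's label). $\Box^\bullet\phi:=\digamma p.\Box(\phi\wedge p)$ with $p$ not in $\phi$. $\mathsf{CHL}$: least set of cyclic formulas containing all substitution instances of propositional tautologies, all $\Box(\phi\to\psi)\to(\Box\phi\to\Box\psi)$, all $\phi\leftrightarrow\psi$ with $\phi\simeq\psi$, closed under modus ponens, necessitation and Löb's rule (from $\vdash\Box\phi\to\phi$ infer $\vdash\phi$). $\mathsf{GL}^\circ$ is $\mathsf{CHL}$ extended with all instances of $\Box\phi\to\Box\Box\phi$ and closed under the same rules. -}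

module Defs where

open import Data.Nat using (ℕ; zero; suc; _+_)
open import Data.Fin using (Fin; zero; suc; _↑ˡ_; _↑ʳ_; splitAt)
open import Data.List using (List; []; _∷_; _++_; map; length)
open import Data.List.Membership.Propositional using (_∈_)
open import Data.List.Relation.Unary.Any using (Any)
open import Data.List.Relation.Unary.Unique.Propositional using (Unique)
open import Data.List.Relation.Unary.Linked using (Linked)
open import Data.List.Relation.Binary.Pointwise using (Pointwise)
open import Data.Sum using (inj₁; inj₂)
open import Data.Product using (Σ; _×_; _,_)
open import Data.Bool using (Bool; true; false; not; _∧_; _∨_)
open import Data.Empty using (⊥)
open import Relation.Binary.PropositionalEquality using (_≡_)
open import Relation.Binary.Construct.Closure.ReflexiveTransitive using (Star)

data Label : Set where
  L⊥ L⊤ : Label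
  Lvar  : ℕ → Label
  L¬ L□ : Label
  L∧ L∨ L→ : Label

arity : Label → ℕ
arity L⊥ = 0
arity L⊤ = 0
arity (Lvar _) = 0
arity L¬ = 1
arity L□ = 1
arity L∧ = 2
arity L∨ = 2
arity L→ = 2

-- Raw (pointed, labelled, ordered) graphs on vertex set Fin size.
-- The well-formedness conditions are separate predicates below.

record Graph : Set where
  constructor mkGraph
  field
    size  : ℕ
    root  : Fin size
    label : Fin size → Label
    succ  : Fin size → List (Fin size)
open Graph public

Edge : (G : Graph) → Fin (size G) → Fin (size G) → Set
Edge G v w = w ∈ succ G v

IsGraph : Graph → Set
IsGraph G = ((v : Fin (size G)) → length (succ G v) ≡ arity (label G v))
          × ((v : Fin (size G)) → Star (Edge G) (root G) v)

IsCycle : (G : Graph) → Fin (size G) → List (Fin (size G)) → Set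
IsCycle G v vs = Unique (v ∷ vs) × Linked (Edge G) (v ∷ vs ++ v ∷ [])

IsFormula : Graph → Set
IsFormula G = IsGraph G
  × ((v : Fin (size G)) (vs : List (Fin (size G))) → IsCycle G v vs →
       Any (λ w → label G w ≡ L□) (v ∷ vs))

IsBisim : (G H : Graph) → (Fin (size G) → Fin (size H) → Set) → Set
IsBisim G H R = ∀ a a' → R a a' →
  (label G a ≡ label H a') × Pointwise R (succ G a) (succ H a')

_≃_ : Graph → Graph → Set₁
G ≃ H = Σ (Fin (size G) → Fin (size H) → Set) λ R →
          IsBisim G H R × R (root G) (root H)

const : Label → Graph
const l = mkGraph 1 zero (λ _ → l) (λ _ → [])

unary : Label → Graph → Graph
unary l G = mkGraph (suc (size G)) zero lab suc'
  where
  lab : Fin (suc (size G)) → Label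
  lab zero = l
  lab (suc v) = label G v
  suc' : Fin (suc (size G)) → List (Fin (suc (size G)))
  suc' zero = suc (root G) ∷ []
  suc' (suc v) = map suc (succ G v)

binary : Label → Graph → Graph → Graph
binary l G H = mkGraph (suc (size G + size H)) zero lab suc'
  where
  n = size G
  m = size H
  inG : Fin n → Fin (suc (n + m))
  inG v = suc (v ↑ˡ m)
  inH : Fin m → Fin (suc (n + m))
  inH w = suc (n ↑ʳ w)
  lab : Fin (suc (n + m)) → Label
  lab zero = l
  lab (suc x) with splitAt n x
  ... | inj₁ v = label G v
  ... | inj₂ w = label H w
  suc' : Fin (suc (n + m)) → List (Fin (suc (n + m)))
  suc' zero = inG (root G) ∷ inH (root H) ∷ []
  suc' (suc x) with splitAt n x
  ... | inj₁ v = map inG (succ G v)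
  ... | inj₂ w = map inH (succ H w)

‵⊥ ‵⊤ : Graph
‵⊥ = const L⊥
‵⊤ = const L⊤

‵¬_ □_ : Graph → Graph
‵¬ G = unary L¬ G
□ G = unary L□ G

_‵∧_ _‵∨_ _‵→_ _‵↔_ : Graph → Graph → Graph
G ‵∧ H = binary L∧ G H
G ‵∨ H = binary L∨ G H
G ‵→ H = binary L→ G H
G ‵↔ H = (G ‵→ H) ‵∧ (H ‵→ G)

infixr 6 _‵∧_ _‵∨_
infixr 5 _‵→_
infix 4 _‵↔_
infix 7 ‵¬_ □_

-- □•φ := ϝp.□(φ ∧ p) (p fresh).  The graph □(φ ∧ p) has root r (□),
-- an ∧-vertex a, a copy of φ and one p-vertex; ϝp identifies the
-- p-vertex with the root r, giving exactly the following graph: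
--   0 : □ with successor 1;  1 : ∧ with successors (root φ, 0);
--   2+v : copy of φ.
□• : Graph → Graph
□• G = mkGraph (suc (suc (size G))) zero lab suc'
  where
  lab : Fin (suc (suc (size G))) → Label
  lab zero = L□
  lab (suc zero) = L∧
  lab (suc (suc v)) = label G v
  suc' : Fin (suc (suc (size G))) → List (Fin (suc (suc (size G))))
  suc' zero = suc zero ∷ []
  suc' (suc zero) = suc (suc (root G)) ∷ zero ∷ []
  suc' (suc (suc v)) = map (λ w → suc (suc w)) (succ G v)

data PForm : Set where
  pvar : ℕ → PForm
  p⊥ p⊤ : PForm
  p¬ : PForm → PForm
  _p∧_ _p∨_ _p→_ : PForm → PForm → PForm

eval : (ℕ → Bool) → PForm → Bool
eval ρ (pvar i) = ρ i
eval ρ p⊥ = false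
eval ρ p⊤ = true
eval ρ (p¬ A) = not (eval ρ A)
eval ρ (A p∧ B) = eval ρ A ∧ eval ρ B
eval ρ (A p∨ B) = eval ρ A ∨ eval ρ B
eval ρ (A p→ B) = not (eval ρ A) ∨ eval ρ B

Tautology : PForm → Set
Tautology A = (ρ : ℕ → Bool) → eval ρ A ≡ true

inst : (ℕ → Graph) → PForm → Graph
inst σ (pvar i) = σ i
inst σ p⊥ = ‵⊥
inst σ p⊤ = ‵⊤
inst σ (p¬ A) = ‵¬ inst σ A
inst σ (A p∧ B) = inst σ A ‵∧ inst σ B
inst σ (A p∨ B) = inst σ A ‵∨ inst σ B
inst σ (A p→ B) = inst σ A ‵→ inst σ B

data Deriv (Ax : Graph → Set) : Graph → Set₁ where
  ax-extra : ∀ {φ} → Ax φ → Deriv Ax φ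
  ax-taut  : (A : PForm) (σ : ℕ → Graph) → ((i : ℕ) → IsFormula (σ i)) →
             Tautology A → Deriv Ax (inst σ A)
  ax-K     : (φ ψ : Graph) → IsFormula φ → IsFormula ψ →
             Deriv Ax (□ (φ ‵→ ψ) ‵→ (□ φ ‵→ □ ψ))
  ax-bisim : (φ ψ : Graph) → IsFormula φ → IsFormula ψ → φ ≃ ψ →
             Deriv Ax (φ ‵↔ ψ)
  mp       : ∀ {φ ψ} → Deriv Ax φ → Deriv Ax (φ ‵→ ψ) → Deriv Ax ψ
  nec      : ∀ {φ} → Deriv Ax φ → Deriv Ax (□ φ)
  löb      : ∀ {φ} → Deriv Ax (□ φ ‵→ φ) → Deriv Ax φ

NoAx : Graph → Set
NoAx _ = ⊥

Ax4 : Graph → Set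
Ax4 χ = Σ Graph λ φ → IsFormula φ × (χ ≡ (□ φ ‵→ □ □ φ))

CHL⊢_ : Graph → Set₁
CHL⊢ φ = Deriv NoAx φ

GL°⊢_ : Graph → Set₁
GL°⊢ φ = Deriv Ax4 φ

{-# OPTIONS --safe #-}

-- □•φ is bisimilar to its unfolding □(φ ∧ □•φ), so the bisimulation axiom turns the
-- fixpoint equation into a provable equivalence. The direction □•φ → □φ then follows by
-- monotonicity of □. For □φ → □•φ one applies Löb's rule: the transitivity axiom supplies
-- the □□φ needed to unfold □•φ under the box. The side conditions (every graph built is a
-- cyclic formula) hold because each construction embeds its arguments as successor-closed
-- subgraphs and only adds vertices lying on no cycle or on a boxed one.

module Submission where

open import Defs
open import Data.Bool using (Bool; true; false; not; _∧_; _∨_; T)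
open import Data.Bool.Properties using (T-∧; T-≡)
open import Data.Nat using (ℕ; zero; suc; _+_; _⊔_; _<_; s≤s)
open import Data.Nat.Properties using (n<1+n; m<n⇒m<n⊔o; m<n⇒m<o⊔n)
open import Data.Fin using (Fin; zero; suc; _↑ˡ_; _↑ʳ_; splitAt; join)
open import Data.Fin.Properties using (splitAt-↑ˡ; splitAt-↑ʳ; join-splitAt; ↑ˡ-injective; ↑ʳ-injective; suc-injective)
open import Data.List using (List; []; _∷_; _++_; map; length)
open import Data.List.Properties using (length-map; map-∘)
open import Data.List.Membership.Propositional using (_∈_; lose)
open import Data.List.Membership.Propositional.Properties using (∈-map⁺; ∈-map⁻)
open import Data.List.Relation.Unary.All using (All; []; _∷_)
open import Data.List.Relation.Unary.Any as Any using (Any; here; there)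
import Data.List.Relation.Unary.Any.Properties as Anyₚ
open import Data.List.Relation.Unary.Unique.Propositional.Properties as Unique using ()
open import Data.List.Relation.Unary.Linked using (Linked; [-]; _∷_)
open import Data.List.Relation.Binary.Pointwise as Pointwise using (Pointwise; []; _∷_)
open import Data.Vec using (Vec; []; _∷_)
open import Data.Sum using (inj₁; inj₂)
open import Data.Product using (_×_; _,_; proj₁; proj₂; ∃-syntax)
open import Data.Empty using (⊥-elim)
open import Function using (_∘_; it)
open import Function.Bundles using (Equivalence)
open import Relation.Nullary using (¬_)
open import Relation.Binary.PropositionalEquality using (_≡_; refl; sym; trans; cong; cong₂; subst; module ≡-Reasoning)
open import Relation.Binary.Construct.Closure.ReflexiveTransitive using (Star; ε; _◅_; gmap)

variable
  φ ψ χ : Graph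

BoxedCycles : Graph → Set
BoxedCycles G = (v : Fin (size G)) (vs : List (Fin (size G))) → IsCycle G v vs →
  Any (λ w → label G w ≡ L□) (v ∷ vs)

predecessor-of-last : ∀ {A : Set} {R : A → A → Set} x xs y →
  Linked R (x ∷ xs ++ y ∷ []) → ∃[ u ] u ∈ x ∷ xs × R u y
predecessor-of-last x [] y (r ∷ _) = x , here refl , r
predecessor-of-last x (z ∷ zs) y (_ ∷ l) with predecessor-of-last z zs y l
... | u , u∈ , r = u , there u∈ , r

source-not-on-cycle : ∀ {G v} vs → (∀ u → ¬ Edge G u v) → ¬ IsCycle G v vs
source-not-on-cycle vs source (_ , l) with predecessor-of-last _ vs _ l
... | u , _ , e = source u e

record Embedding (G H : Graph) : Set where
  field
    ι           : Fin (size G) → Fin (size H)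
    ι-injective : ∀ {v w} → ι v ≡ ι w → v ≡ w
    succ-ι      : ∀ v → succ H (ι v) ≡ map ι (succ G v)
    label-ι     : ∀ v → label H (ι v) ≡ label G v

module _ {G H : Graph} (e : Embedding G H) where
  open Embedding e

  embed-edge : ∀ {v w} → Edge G v w → Edge H (ι v) (ι w)
  embed-edge {v} w∈ = subst (_ ∈_) (sym (succ-ι v)) (∈-map⁺ ι w∈)

  embed-edge⁻ : ∀ {v x} → Edge H (ι v) x → ∃[ w ] x ≡ ι w × Edge G v w
  embed-edge⁻ {v} x∈ with ∈-map⁻ ι (subst (_ ∈_) (succ-ι v) x∈)
  ... | w , w∈ , x≡ιw = w , x≡ιw , w∈

  embed-path : ∀ {v w} → Star (Edge G) v w → Star (Edge H) (ι v) (ι w)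
  embed-path = gmap ι embed-edge

  embed-arity : (∀ v → length (succ G v) ≡ arity (label G v)) →
    ∀ v → length (succ H (ι v)) ≡ arity (label H (ι v))
  embed-arity arity-G v = begin
    length (succ H (ι v))      ≡⟨ cong length (succ-ι v) ⟩
    length (map ι (succ G v))  ≡⟨ length-map ι (succ G v) ⟩
    length (succ G v)          ≡⟨ arity-G v ⟩
    arity (label G v)          ≡⟨ cong arity (label-ι v) ⟨
    arity (label H (ι v))      ∎
    where open ≡-Reasoning

  embed-linked⁻ : ∀ {v w} xs → Linked (Edge H) (ι v ∷ xs ++ ι w ∷ []) →
    ∃[ vs ] xs ≡ map ι vs × Linked (Edge G) (v ∷ vs ++ w ∷ [])
  embed-linked⁻ [] (e ∷ [-]) with embed-edge⁻ e
  ... | u , ιw≡ιu , e′ = [] , refl , subst (Edge G _) (sym (ι-injective ιw≡ιu)) e′ ∷ [-]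
  embed-linked⁻ (x ∷ xs) (e ∷ l) with embed-edge⁻ e
  ... | u , refl , e′ with embed-linked⁻ xs l
  ... | vs , refl , l′ = u ∷ vs , refl , e′ ∷ l′

  embed-cycle⁻ : ∀ {v} ws → IsCycle H (ι v) ws → ∃[ vs ] ws ≡ map ι vs × IsCycle G v vs
  embed-cycle⁻ ws (unique , l) with embed-linked⁻ ws l
  ... | vs , refl , l′ = vs , refl , Unique.map⁻ unique , l′

  embed-boxed : BoxedCycles G → ∀ v ws → IsCycle H (ι v) ws →
    Any (λ x → label H x ≡ L□) (ι v ∷ ws)
  embed-boxed boxed v ws c with embed-cycle⁻ ws c
  ... | vs , refl , c′ = Anyₚ.map⁺ (Any.map (λ {x} □x → trans (label-ι x) □x) (boxed v vs c′))

embedding-∘ : ∀ {G H K} → Embedding H K → Embedding G H → Embedding G K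
embedding-∘ {G} {H} {K} f g = record
  { ι           = f.ι ∘ g.ι
  ; ι-injective = g.ι-injective ∘ f.ι-injective
  ; succ-ι      = succ-∘
  ; label-ι     = λ v → trans (f.label-ι (g.ι v)) (g.label-ι v)
  }
  where
  module f = Embedding f
  module g = Embedding g
  succ-∘ : ∀ v → succ K (f.ι (g.ι v)) ≡ map (f.ι ∘ g.ι) (succ G v)
  succ-∘ v = begin
    succ K (f.ι (g.ι v))            ≡⟨ f.succ-ι (g.ι v) ⟩
    map f.ι (succ H (g.ι v))        ≡⟨ cong (map f.ι) (g.succ-ι v) ⟩
    map f.ι (map g.ι (succ G v))    ≡⟨ map-∘ (succ G v) ⟨
    map (f.ι ∘ g.ι) (succ G v)      ∎
    where open ≡-Reasoning

unary-embedding : ∀ l G → Embedding G (unary l G)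
unary-embedding l G = record
  { ι = suc ; ι-injective = suc-injective ; succ-ι = λ _ → refl ; label-ι = λ _ → refl }

unary-root-source : ∀ l G u → ¬ Edge (unary l G) u zero
unary-root-source l G zero (there ())
unary-root-source l G (suc w) e with embed-edge⁻ (unary-embedding l G) e
... | _ , () , _

unary-formula : ∀ {l G} → arity l ≡ 1 → IsFormula G → IsFormula (unary l G)
unary-formula {l} {G} ar ((arity-G , reach-G) , boxed-G) = (arity-U , reach-U) , boxed-U
  where
  U : Graph
  U = unary l G
  e : Embedding G U
  e = unary-embedding l G
  arity-U : ∀ v → length (succ U v) ≡ arity (label U v)
  arity-U zero = sym ar
  arity-U (suc v) = embed-arity e arity-G v
  reach-U : ∀ v → Star (Edge U) (root U) v
  reach-U zero = ε
  reach-U (suc v) = here refl ◅ embed-path e (reach-G v)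
  boxed-U : BoxedCycles U
  boxed-U zero vs c = ⊥-elim (source-not-on-cycle {U} vs (unary-root-source l G) c)
  boxed-U (suc v) = embed-boxed e boxed-G v

data SplitView (m n : ℕ) : Fin (m + n) → Set where
  inˡ : ∀ i → SplitView m n (i ↑ˡ n)
  inʳ : ∀ j → SplitView m n (m ↑ʳ j)

splitView : ∀ m n i → SplitView m n i
splitView m n i = subst (SplitView m n) (join-splitAt m n i) (view-join (splitAt m i))
  where
  view-join : ∀ s → SplitView m n (join m n s)
  view-join (inj₁ i) = inˡ i
  view-join (inj₂ j) = inʳ j

module _ (l : Label) (G H : Graph) where
  private
    m n : ℕ
    m = size G
    n = size H
    B : Graph
    B = binary l G H

    ιˡ : Fin m → Fin (size B)
    ιˡ v = suc (v ↑ˡ n)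
    ιʳ : Fin n → Fin (size B)
    ιʳ w = suc (m ↑ʳ w)

    succ-ιˡ : ∀ v → succ B (ιˡ v) ≡ map ιˡ (succ G v)
    succ-ιˡ v rewrite splitAt-↑ˡ m v n = refl
    succ-ιʳ : ∀ w → succ B (ιʳ w) ≡ map ιʳ (succ H w)
    succ-ιʳ w rewrite splitAt-↑ʳ m n w = refl
    label-ιˡ : ∀ v → label B (ιˡ v) ≡ label G v
    label-ιˡ v rewrite splitAt-↑ˡ m v n = refl
    label-ιʳ : ∀ w → label B (ιʳ w) ≡ label H w
    label-ιʳ w rewrite splitAt-↑ʳ m n w = refl

  binary-embeddingˡ : Embedding G B
  binary-embeddingˡ = record
    { ι = ιˡ ; ι-injective = ↑ˡ-injective n _ _ ∘ suc-injective
    ; succ-ι = succ-ιˡ ; label-ι = label-ιˡ }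

  binary-embeddingʳ : Embedding H B
  binary-embeddingʳ = record
    { ι = ιʳ ; ι-injective = ↑ʳ-injective m _ _ ∘ suc-injective
    ; succ-ι = succ-ιʳ ; label-ι = label-ιʳ }

  binary-root-source : ∀ u → ¬ Edge B u zero
  binary-root-source zero (there (there ()))
  binary-root-source (suc x) e with splitView m n x
  ... | inˡ v with embed-edge⁻ binary-embeddingˡ e
  ...   | _ , () , _
  binary-root-source (suc x) e | inʳ w with embed-edge⁻ binary-embeddingʳ e
  ...   | _ , () , _

  binary-formula : arity l ≡ 2 → IsFormula G → IsFormula H → IsFormula B
  binary-formula ar ((arity-G , reach-G) , boxed-G) ((arity-H , reach-H) , boxed-H) =
    (arity-B , reach-B) , boxed-B
    where
    arity-B : ∀ v → length (succ B v) ≡ arity (label B v)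
    arity-B zero = sym ar
    arity-B (suc x) with splitView m n x
    ... | inˡ v = embed-arity binary-embeddingˡ arity-G v
    ... | inʳ w = embed-arity binary-embeddingʳ arity-H w
    reach-B : ∀ v → Star (Edge B) (root B) v
    reach-B zero = ε
    reach-B (suc x) with splitView m n x
    ... | inˡ v = here refl ◅ embed-path binary-embeddingˡ (reach-G v)
    ... | inʳ w = there (here refl) ◅ embed-path binary-embeddingʳ (reach-H w)
    boxed-B : BoxedCycles B
    boxed-B zero vs c = ⊥-elim (source-not-on-cycle {B} vs binary-root-source c)
    boxed-B (suc x) vs c with splitView m n x
    ... | inˡ v = embed-boxed binary-embeddingˡ boxed-G v vs c
    ... | inʳ w = embed-boxed binary-embeddingʳ boxed-H w vs c

□•-embedding : ∀ G → Embedding G (□• G)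
□•-embedding G = record
  { ι           = λ v → suc (suc v)
  ; ι-injective = suc-injective ∘ suc-injective
  ; succ-ι      = λ _ → refl
  ; label-ι     = λ _ → refl
  }

□•-∧-predecessor : ∀ G u → Edge (□• G) u (suc zero) → u ≡ zero
□•-∧-predecessor G zero _ = refl
□•-∧-predecessor G (suc zero) (there (there ()))
□•-∧-predecessor G (suc (suc w)) e with embed-edge⁻ (□•-embedding G) e
... | _ , () , _

‵⊤-formula : IsFormula ‵⊤
‵⊤-formula = ((λ _ → refl) , λ { zero → ε }) , no-cycle
  where
  no-cycle : BoxedCycles ‵⊤
  no-cycle v vs (_ , l) with predecessor-of-last _ vs _ l
  ... | _ , _ , ()

instance
  □-formula : {{IsFormula φ}} → IsFormula (□ φ)
  □-formula {{φ-formula}} = unary-formula refl φ-formula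

  ‵∧-formula : {{IsFormula φ}} → {{IsFormula ψ}} → IsFormula (φ ‵∧ ψ)
  ‵∧-formula {{φ-formula}} {{ψ-formula}} = binary-formula L∧ _ _ refl φ-formula ψ-formula

  ‵→-formula : {{IsFormula φ}} → {{IsFormula ψ}} → IsFormula (φ ‵→ ψ)
  ‵→-formula {{φ-formula}} {{ψ-formula}} = binary-formula L→ _ _ refl φ-formula ψ-formula

  □•-formula : {{IsFormula φ}} → IsFormula (□• φ)
  □•-formula {φ} {{(arity-φ , reach-φ) , boxed-φ}} = (arity-D , reach-D) , boxed-D
    where
    D : Graph
    D = □• φ
    e : Embedding φ D
    e = □•-embedding φ
    arity-D : ∀ v → length (succ D v) ≡ arity (label D v)
    arity-D zero = refl
    arity-D (suc zero) = refl
    arity-D (suc (suc v)) = embed-arity e arity-φ v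
    reach-D : ∀ v → Star (Edge D) (root D) v
    reach-D zero = ε
    reach-D (suc zero) = here refl ◅ ε
    reach-D (suc (suc v)) = here refl ◅ here refl ◅ embed-path e (reach-φ v)
    boxed-D : BoxedCycles D
    boxed-D zero _ _ = here refl
    boxed-D (suc zero) vs (_ , l) with predecessor-of-last _ vs _ l
    ... | u , u∈ , edge with □•-∧-predecessor φ u edge
    ... | refl = lose u∈ refl
    boxed-D (suc (suc v)) = embed-boxed e boxed-φ v

module _ (φ : Graph) where
  private
    B K : Graph
    B = □• φ
    K = □ (φ ‵∧ B)
    φ↪K : Embedding φ K
    φ↪K = embedding-∘ (unary-embedding L□ (φ ‵∧ B)) (binary-embeddingˡ L∧ φ B)
    B↪K : Embedding B K
    B↪K = embedding-∘ (unary-embedding L□ (φ ‵∧ B)) (binary-embeddingʳ L∧ φ B)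
    open Embedding

  data Unfolding : Fin (size B) → Fin (size K) → Set where
    □-root : Unfolding zero zero
    ∧-root : Unfolding (suc zero) (suc zero)
    in-φ   : ∀ v → Unfolding (suc (suc v)) (ι φ↪K v)
    in-□•  : ∀ x → Unfolding x (ι B↪K x)

  unfolding-bisim : IsBisim B K Unfolding
  unfolding-bisim _ _ □-root = refl , ∧-root ∷ []
  unfolding-bisim _ _ ∧-root = refl , in-φ (root φ) ∷ in-□• zero ∷ []
  unfolding-bisim _ _ (in-φ v) =
    sym (label-ι φ↪K v) ,
    subst (Pointwise Unfolding _) (sym (succ-ι φ↪K v))
      (Pointwise.map⁺ (λ w → suc (suc w)) (ι φ↪K) (Pointwise.refl (in-φ _)))
  unfolding-bisim _ _ (in-□• x) =
    sym (label-ι B↪K x) ,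
    subst (Pointwise Unfolding _) (sym (succ-ι B↪K x)) (copy-related (succ B x))
    where
    copy-related : ∀ xs → Pointwise Unfolding xs (map (ι B↪K) xs)
    copy-related [] = []
    copy-related (y ∷ ys) = in-□• y ∷ copy-related ys

  □•-unfold : □• φ ≃ (□ (φ ‵∧ □• φ))
  □•-unfold = Unfolding , unfolding-bisim , □-root

varBound : PForm → ℕ
varBound (pvar i)  = suc i
varBound p⊥        = 0
varBound p⊤        = 0
varBound (p¬ A)    = varBound A
varBound (A p∧ B)  = varBound A ⊔ varBound B
varBound (A p∨ B)  = varBound A ⊔ varBound B
varBound (A p→ B)  = varBound A ⊔ varBound B

eval-local : ∀ {ρ ρ′} A → (∀ {i} → i < varBound A → ρ i ≡ ρ′ i) → eval ρ A ≡ eval ρ′ A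
eval-local (pvar i) agree = agree (n<1+n i)
eval-local p⊥ _ = refl
eval-local p⊤ _ = refl
eval-local (p¬ A) agree = cong not (eval-local A agree)
eval-local (A p∧ B) agree =
  cong₂ _∧_ (eval-local A (agree ∘ m<n⇒m<n⊔o _)) (eval-local B (agree ∘ m<n⇒m<o⊔n _))
eval-local (A p∨ B) agree =
  cong₂ _∨_ (eval-local A (agree ∘ m<n⇒m<n⊔o _)) (eval-local B (agree ∘ m<n⇒m<o⊔n _))
eval-local (A p→ B) agree =
  cong₂ (λ a b → not a ∨ b) (eval-local A (agree ∘ m<n⇒m<n⊔o _)) (eval-local B (agree ∘ m<n⇒m<o⊔n _))

valuation : ∀ {n} → Vec Bool n → ℕ → Bool
valuation []       _       = false
valuation (b ∷ _)  zero    = b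
valuation (_ ∷ bs) (suc i) = valuation bs i

restrict : ∀ n → (ℕ → Bool) → Vec Bool n
restrict zero    _ = []
restrict (suc n) ρ = ρ 0 ∷ restrict n (ρ ∘ suc)

valuation-restrict : ∀ n ρ {i} → i < n → valuation (restrict n ρ) i ≡ ρ i
valuation-restrict (suc n) ρ {zero}  _          = refl
valuation-restrict (suc n) ρ {suc i} (s≤s i<n)  = valuation-restrict n (ρ ∘ suc) i<n

everyValuation : ∀ n → (Vec Bool n → Bool) → Bool
everyValuation zero    f = f []
everyValuation (suc n) f = everyValuation n (f ∘ (true ∷_)) ∧ everyValuation n (f ∘ (false ∷_))

everyValuation-sound : ∀ n f → T (everyValuation n f) → ∀ bs → T (f bs)
everyValuation-sound zero    f t []           = t
everyValuation-sound (suc n) f t (true ∷ bs)  =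
  everyValuation-sound n _ (proj₁ (Equivalence.to T-∧ t)) bs
everyValuation-sound (suc n) f t (false ∷ bs) =
  everyValuation-sound n _ (proj₂ (Equivalence.to T-∧ t)) bs

tautology? : PForm → Bool
tautology? A = everyValuation (varBound A) (λ bs → eval (valuation bs) A)

tautology?-sound : ∀ A → T (tautology? A) → Tautology A
tautology?-sound A t ρ = begin
  eval ρ A                          ≡⟨ eval-local A (λ i<n → sym (valuation-restrict n ρ i<n)) ⟩
  eval (valuation (restrict n ρ)) A ≡⟨ Equivalence.to T-≡ (everyValuation-sound n _ t (restrict n ρ)) ⟩
  true                              ∎
  where
  n : ℕ
  n = varBound A
  open ≡-Reasoning

substitution : List Graph → ℕ → Graph
substitution []       _       = ‵⊤
substitution (φ ∷ _)  zero    = φ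
substitution (_ ∷ φs) (suc i) = substitution φs i

substitution-formula : ∀ {φs} → All IsFormula φs → ∀ i → IsFormula (substitution φs i)
substitution-formula []       _       = ‵⊤-formula
substitution-formula (φ ∷ _)  zero    = φ
substitution-formula (_ ∷ fs) (suc i) = substitution-formula fs i

instance
  All-[] : All IsFormula []
  All-[] = []

  All-∷ : ∀ {φ φs} → {{IsFormula φ}} → {{All IsFormula φs}} → All IsFormula (φ ∷ φs)
  All-∷ {{φ-formula}} {{φs-formula}} = φ-formula ∷ φs-formula

private
  p q r s t u : PForm
  p = pvar 0
  q = pvar 1
  r = pvar 2
  s = pvar 3
  t = pvar 4
  u = pvar 5

module _ {Ax : Graph → Set} where

  taut : (A : PForm) {_ : T (tautology? A)} (φs : List Graph) {{_ : All IsFormula φs}} →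
         Deriv Ax (inst (substitution φs) A)
  taut A {valid} φs {{φs-formula}} =
    ax-taut A (substitution φs) (substitution-formula φs-formula) (tautology?-sound A valid)

  →-trans : {{IsFormula φ}} → {{IsFormula ψ}} → {{IsFormula χ}} →
            Deriv Ax (φ ‵→ ψ) → Deriv Ax (ψ ‵→ χ) → Deriv Ax (φ ‵→ χ)
  →-trans {φ} {ψ} {χ} φ→ψ ψ→χ =
    mp ψ→χ (mp φ→ψ (taut ((p p→ q) p→ ((q p→ r) p→ (p p→ r))) (φ ∷ ψ ∷ χ ∷ [])))

  ↔-elimˡ : {{IsFormula φ}} → {{IsFormula ψ}} → Deriv Ax (φ ‵↔ ψ) → Deriv Ax (φ ‵→ ψ)
  ↔-elimˡ {φ} {ψ} φ↔ψ = mp φ↔ψ (taut (((p p→ q) p∧ (q p→ p)) p→ (p p→ q)) (φ ∷ ψ ∷ []))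

  ↔-elimʳ : {{IsFormula φ}} → {{IsFormula ψ}} → Deriv Ax (φ ‵↔ ψ) → Deriv Ax (ψ ‵→ φ)
  ↔-elimʳ {φ} {ψ} φ↔ψ = mp φ↔ψ (taut (((p p→ q) p∧ (q p→ p)) p→ (q p→ p)) (φ ∷ ψ ∷ []))

  ↔-intro : {{IsFormula φ}} → {{IsFormula ψ}} →
            Deriv Ax (φ ‵→ ψ) → Deriv Ax (ψ ‵→ φ) → Deriv Ax (φ ‵↔ ψ)
  ↔-intro {φ} {ψ} φ→ψ ψ→φ =
    mp ψ→φ (mp φ→ψ (taut (p p→ (q p→ (p p∧ q))) ((φ ‵→ ψ) ∷ (ψ ‵→ φ) ∷ [])))

  □-mono : {{IsFormula φ}} → {{IsFormula ψ}} → Deriv Ax (φ ‵→ ψ) → Deriv Ax (□ φ ‵→ □ ψ)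
  □-mono {φ} {ψ} φ→ψ = mp (nec φ→ψ) (ax-K φ ψ it it)

  □-∧-intro : {{IsFormula φ}} → {{IsFormula ψ}} → Deriv Ax (□ φ ‵→ (□ ψ ‵→ □ (φ ‵∧ ψ)))
  □-∧-intro {φ} {ψ} =
    →-trans (□-mono (taut (p p→ (q p→ (p p∧ q))) (φ ∷ ψ ∷ []))) (ax-K ψ (φ ‵∧ ψ) it it)

□•-fixpoint : ∀ {Ax} → {{IsFormula φ}} → Deriv Ax (□• φ ‵↔ □ (φ ‵∧ □• φ))
□•-fixpoint {φ} = ax-bisim _ _ it it (□•-unfold φ)

□•→□ : ∀ {Ax} → {{IsFormula φ}} → Deriv Ax (□• φ ‵→ □ φ)
□•→□ {φ} = →-trans (↔-elimˡ □•-fixpoint) (□-mono (taut ((p p∧ q) p→ p) (φ ∷ □• φ ∷ [])))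

-- Löb's rule applied to □(□φ → □•φ) → (□φ → □•φ): given □(□φ → □•φ) and □φ,
-- axiom 4 yields □□φ, hence □□•φ; with □φ this gives □(φ ∧ □•φ), which unfolds to □•φ.
□→□• : {{IsFormula φ}} → GL°⊢ (□ φ ‵→ □• φ)
□→□• {φ} = löb (mp fold (mp □-∧ (mp four (mp k (taut combine premises)))))
  where
  premises : List Graph
  premises = □ (□ φ ‵→ □• φ) ∷ □ □ φ ∷ □ □• φ ∷ □ φ ∷ □ (φ ‵∧ □• φ) ∷ □• φ ∷ []
  combine : PForm
  combine = (p p→ (q p→ r)) p→ ((s p→ q) p→ ((s p→ (r p→ t)) p→ ((t p→ u) p→ (p p→ (s p→ u)))))
  k : GL°⊢ (□ (□ φ ‵→ □• φ) ‵→ (□ □ φ ‵→ □ □• φ))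
  k = ax-K _ _ it it
  four : GL°⊢ (□ φ ‵→ □ □ φ)
  four = ax-extra (φ , it , refl)
  □-∧ : GL°⊢ (□ φ ‵→ (□ □• φ ‵→ □ (φ ‵∧ □• φ)))
  □-∧ = □-∧-intro
  fold : GL°⊢ (□ (φ ‵∧ □• φ) ‵→ □• φ)
  fold = ↔-elimʳ □•-fixpoint

□•↔□ : {{IsFormula φ}} → GL°⊢ (□• φ ‵↔ □ φ)
□•↔□ = ↔-intro □•→□ □→□•

theorem4p4 : (φ : Graph) → IsFormula φ → GL°⊢ (□• φ ‵↔ □ φ)
theorem4p4 φ φ-formula = □•↔□ {{φ-formula}}
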